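{- For any graphs $G$ and $J$ (not necessarily connected), $\Upsilon(G \vee J) \leq \Upsilon(G) + \Upsilon(J)$.
   Context: For a graph $G$ (possibly disconnected), $N(v)$ denotes the open neighbourhood of $v$. A non-empty set $S \subseteq V(G)$ is a small common neighbourhood set of $G$ if $\left|\bigcap_{v \in S} N(v)\right| \leq |S|$; $\Upsilon(G)$ is the minimum cardinality of a small common neighbourhood set of $G$. The join $G \vee J$ has vertex set $V(G) \cup V(J)$ (disjoint union) and edge set $E(G) \cup E(J) \cup \{uv : u \in V(G), v \in V(J)\}$. -}

module Defs where

open import Data.Nat using (ℕ; _+_; _≤_)
open import Data.Bool using (Bool; true; false; if_then_else_)
open import Data.Fin using (Fin; splitAt)
open import Data.Fin.Subset using (Subset; inside; outside; _∈_; ⋂; ∣_∣; Nonempty)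
open import Data.Fin.Subset.Properties using (_∈?_)
open import Data.List using (List; map; filter)
open import Data.List.Base using () renaming (allFin to allFinL)
open import Data.Sum using (_⊎_; inj₁; inj₂)
open import Data.Vec using (tabulate)
open import Data.Product using (_×_)
open import Relation.Binary.PropositionalEquality using (_≡_; refl)

record Graph : Set where
  field
    order  : ℕ
    adj    : Fin order → Fin order → Bool
    sym    : ∀ u v → adj u v ≡ adj v u
    irrefl : ∀ v → adj v v ≡ false
open Graph public

N : (G : Graph) → Fin (order G) → Subset (order G)
N G v = tabulate (λ w → if adj G v w then inside else outside)

commonNbr : (G : Graph) → Subset (order G) → Subset (order G)
commonNbr G S = ⋂ (map (N G) (filter (_∈? S) (allFinL (order G))))

IsSCNSet : (G : Graph) → Subset (order G) → Set
IsSCNSet G S = Nonempty S × (∣ commonNbr G S ∣ ≤ ∣ S ∣)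

IsUpsilon : Graph → ℕ → Set
IsUpsilon G k =
  (Data.Product.Σ (Subset (order G)) λ S → IsSCNSet G S × ∣ S ∣ ≡ k)
  × (∀ S → IsSCNSet G S → k ≤ ∣ S ∣)

joinAdj : (G J : Graph) → Fin (order G + order J) → Fin (order G + order J) → Bool
joinAdj G J x y with splitAt (order G) x | splitAt (order G) y
... | inj₁ u | inj₁ v = adj G u v
... | inj₂ u | inj₂ v = adj J u v
... | inj₁ _ | inj₂ _ = true
... | inj₂ _ | inj₁ _ = true

joinAdj-sym : ∀ G J x y → joinAdj G J x y ≡ joinAdj G J y x
joinAdj-sym G J x y with splitAt (order G) x | splitAt (order G) y
... | inj₁ u | inj₁ v = sym G u v
... | inj₂ u | inj₂ v = sym J u v
... | inj₁ _ | inj₂ _ = refl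
... | inj₂ _ | inj₁ _ = refl

joinAdj-irrefl : ∀ G J x → joinAdj G J x x ≡ false
joinAdj-irrefl G J x with splitAt (order G) x
... | inj₁ u = irrefl G u
... | inj₂ u = irrefl J u

_∨G_ : Graph → Graph → Graph
G ∨G J = record
  { order = order G + order J
  ; adj = joinAdj G J
  ; sym = joinAdj-sym G J
  ; irrefl = joinAdj-irrefl G J
  }

-- If S and T are minimum small common neighbourhood sets of G and J, then S ∪ T is a small
-- common neighbourhood set of G ∨ J: a common neighbour of S ∪ T lying in G is adjacent (in G)
-- to every vertex of S, and symmetrically in J, so ⋂_{v ∈ S ∪ T} N(v) is contained in
-- ⋂_{v ∈ S} N(v) ∪ ⋂_{v ∈ T} N(v), which has at most |S| + |T| = Υ(G) + Υ(J) elements.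
module Submission where

open import Defs hiding (sym)
open import Data.Nat using (ℕ; suc; _+_; _≤_)
open import Data.Nat.Properties using (+-mono-≤; module ≤-Reasoning)
open import Data.Bool using (true; false; if_then_else_)
open import Data.Fin using (Fin; splitAt; _↑ˡ_; _↑ʳ_)
open import Data.Fin.Properties using (splitAt-↑ˡ; splitAt-↑ʳ; splitAt⁻¹-↑ˡ; splitAt⁻¹-↑ʳ)
open import Data.Fin.Subset using (Subset; inside; outside; _∈_; _⊆_; ⋂; ∣_∣)
open import Data.Fin.Subset.Properties using (_∈?_; ∈⊤; x∈p∩q⁺; x∈p∩q⁻; p⊆q⇒∣p∣≤∣q∣)
open import Data.List using (List; []; _∷_; map; filter; allFin)
open import Data.List.Relation.Unary.Any using (here; there)
open import Data.List.Membership.Propositional using () renaming (_∈_ to _∈ₗ_)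
open import Data.List.Membership.Propositional.Properties
  using (∈-map⁺; ∈-map⁻; ∈-filter⁺; ∈-filter⁻; ∈-allFin)
open import Data.Vec using (_++_; _∷_; []; here; there)
open import Data.Vec.Properties using (lookup∘tabulate; []=⇒lookup; lookup⇒[]=)
open import Data.Sum using (inj₁; inj₂)
open import Data.Product using (_,_; proj₁; proj₂)
open import Relation.Binary.PropositionalEquality
  using (_≡_; refl; sym; trans; cong; cong₂; subst)

∈-⋂⁺ : ∀ {n} {x : Fin n} (ps : List (Subset n)) → (∀ {p} → p ∈ₗ ps → x ∈ p) → x ∈ ⋂ ps
∈-⋂⁺ []       x∈ps = ∈⊤
∈-⋂⁺ (p ∷ ps) x∈ps = x∈p∩q⁺ (x∈ps (here refl) , ∈-⋂⁺ ps (λ p∈ps → x∈ps (there p∈ps)))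

∈-⋂⁻ : ∀ {n} {x : Fin n} {p} (ps : List (Subset n)) → x ∈ ⋂ ps → p ∈ₗ ps → x ∈ p
∈-⋂⁻ (q ∷ ps) x∈⋂ (here refl)  = proj₁ (x∈p∩q⁻ q _ x∈⋂)
∈-⋂⁻ (q ∷ ps) x∈⋂ (there p∈ps) = ∈-⋂⁻ ps (proj₂ (x∈p∩q⁻ q _ x∈⋂)) p∈ps

∈-++⁺ˡ : ∀ {m n} {p : Subset m} {u} (q : Subset n) → u ∈ p → (u ↑ˡ n) ∈ (p ++ q)
∈-++⁺ˡ q here        = here
∈-++⁺ˡ q (there u∈p) = there (∈-++⁺ˡ q u∈p)

∈-++⁺ʳ : ∀ {m n} {q : Subset n} {u} (p : Subset m) → u ∈ q → (m ↑ʳ u) ∈ (p ++ q)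
∈-++⁺ʳ []      u∈q = u∈q
∈-++⁺ʳ (_ ∷ p) u∈q = there (∈-++⁺ʳ p u∈q)

∣p++q∣≡∣p∣+∣q∣ : ∀ {m n} (p : Subset m) (q : Subset n) → ∣ p ++ q ∣ ≡ ∣ p ∣ + ∣ q ∣
∣p++q∣≡∣p∣+∣q∣ []            q = refl
∣p++q∣≡∣p∣+∣q∣ (inside  ∷ p) q = cong suc (∣p++q∣≡∣p∣+∣q∣ p q)
∣p++q∣≡∣p∣+∣q∣ (outside ∷ p) q = ∣p++q∣≡∣p∣+∣q∣ p q

data SplitView (m n : ℕ) : Fin (m + n) → Set where
  left  : (u : Fin m) → SplitView m n (u ↑ˡ n)
  right : (u : Fin n) → SplitView m n (m ↑ʳ u)

splitView : ∀ m n (x : Fin (m + n)) → SplitView m n x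
splitView m n x with splitAt m x in eq
... | inj₁ u = subst (SplitView m n) (splitAt⁻¹-↑ˡ eq) (left u)
... | inj₂ u = subst (SplitView m n) (splitAt⁻¹-↑ʳ eq) (right u)

module _ (G : Graph) where

  ∈-N⁺ : ∀ {v x} → adj G v x ≡ true → x ∈ N G v
  ∈-N⁺ {v} {x} vx = lookup⇒[]= x (N G v)
    (trans (lookup∘tabulate _ x) (cong (λ b → if b then inside else outside) vx))

  ∈-N⁻ : ∀ {v x} → x ∈ N G v → adj G v x ≡ true
  ∈-N⁻ {v} {x} x∈Nv with adj G v x | trans (sym (lookup∘tabulate _ x)) ([]=⇒lookup x∈Nv)
  ... | true  | _  = refl
  ... | false | ()

  ∈-commonNbr⁺ : ∀ {S x} → (∀ {v} → v ∈ S → adj G v x ≡ true) → x ∈ commonNbr G S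
  ∈-commonNbr⁺ {S} {x} adjS = ∈-⋂⁺ (map (N G) members) x∈neighbourhoods
    where
    members : List (Fin (order G))
    members = filter (_∈? S) (allFin (order G))

    x∈neighbourhoods : ∀ {p} → p ∈ₗ map (N G) members → x ∈ p
    x∈neighbourhoods p∈ with v , v∈ , refl ← ∈-map⁻ (N G) p∈ =
      ∈-N⁺ (adjS (proj₂ (∈-filter⁻ (_∈? S) {xs = allFin (order G)} v∈)))

  ∈-commonNbr⁻ : ∀ {S x v} → x ∈ commonNbr G S → v ∈ S → adj G v x ≡ true
  ∈-commonNbr⁻ {S} {v = v} x∈ v∈S =
    ∈-N⁻ (∈-⋂⁻ _ x∈ (∈-map⁺ (N G) (∈-filter⁺ (_∈? S) (∈-allFin v) v∈S)))

module _ (G J : Graph) where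

  adj-∨-↑ˡ : ∀ u v → adj (G ∨G J) (u ↑ˡ order J) (v ↑ˡ order J) ≡ adj G u v
  adj-∨-↑ˡ u v rewrite splitAt-↑ˡ (order G) u (order J) | splitAt-↑ˡ (order G) v (order J) = refl

  adj-∨-↑ʳ : ∀ u v → adj (G ∨G J) (order G ↑ʳ u) (order G ↑ʳ v) ≡ adj J u v
  adj-∨-↑ʳ u v rewrite splitAt-↑ʳ (order G) (order J) u | splitAt-↑ʳ (order G) (order J) v = refl

  commonNbr-∨-⊆ : ∀ {S T} → commonNbr (G ∨G J) (S ++ T) ⊆ commonNbr G S ++ commonNbr J T
  commonNbr-∨-⊆ {S} {T} {x} x∈ with splitView (order G) (order J) x
  ... | left u = ∈-++⁺ˡ _ (∈-commonNbr⁺ G λ {v} v∈S →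
    trans (sym (adj-∨-↑ˡ v u)) (∈-commonNbr⁻ (G ∨G J) x∈ (∈-++⁺ˡ T v∈S)))
  ... | right u = ∈-++⁺ʳ _ (∈-commonNbr⁺ J λ {v} v∈T →
    trans (sym (adj-∨-↑ʳ v u)) (∈-commonNbr⁻ (G ∨G J) x∈ (∈-++⁺ʳ S v∈T)))

  IsSCNSet-∨ : ∀ {S T} → IsSCNSet G S → IsSCNSet J T → IsSCNSet (G ∨G J) (S ++ T)
  IsSCNSet-∨ {S} {T} ((u , u∈S) , smallS) (_ , smallT) = (u ↑ˡ order J , ∈-++⁺ˡ T u∈S) , (begin
    ∣ commonNbr (G ∨G J) (S ++ T) ∣       ≤⟨ p⊆q⇒∣p∣≤∣q∣ commonNbr-∨-⊆ ⟩
    ∣ commonNbr G S ++ commonNbr J T ∣    ≡⟨ ∣p++q∣≡∣p∣+∣q∣ (commonNbr G S) (commonNbr J T) ⟩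
    ∣ commonNbr G S ∣ + ∣ commonNbr J T ∣ ≤⟨ +-mono-≤ smallS smallT ⟩
    ∣ S ∣ + ∣ T ∣                         ≡⟨ ∣p++q∣≡∣p∣+∣q∣ S T ⟨
    ∣ S ++ T ∣                            ∎)
    where open ≤-Reasoning

proposition3p1 : (G J : Graph) (a b c : ℕ) →
    IsUpsilon G a → IsUpsilon J b → IsUpsilon (G ∨G J) c → c ≤ a + b
proposition3p1 G J a b c ((S , scnS , ∣S∣≡a) , _) ((T , scnT , ∣T∣≡b) , _) (_ , minimal) = begin
  c             ≤⟨ minimal (S ++ T) (IsSCNSet-∨ G J scnS scnT) ⟩
  ∣ S ++ T ∣    ≡⟨ ∣p++q∣≡∣p∣+∣q∣ S T ⟩
  ∣ S ∣ + ∣ T ∣ ≡⟨ cong₂ _+_ ∣S∣≡a ∣T∣≡b ⟩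
  a + b         ∎
  where open ≤-Reasoning
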